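{- Let $f,g\in\mathbf{Z}[t]$ be coprime (in $\mathbf{Q}[t]$) polynomials of degrees $r$ and $s$, at least one positive; write $\max(r/4,s/6)=n/m$ with $n,m$ coprime positive integers, and assume $n=1$ or $m=1$. For $(a,b)\in\mathbf{Z}^2$ with $b\neq 0$ put $u=b^n$, $t=a/b^m$, $A=u^4f(t)$, $B=u^6g(t)$ (these are integers). Fix $\kappa>0$ and, for $X\ge1$, let $S_2(X)$ be the set of $(a,b)\in\mathbf{Z}^2$ such that $a,b$ are coprime, $b>0$, $|a|<\kappa X^{m/12n}$, $|b|<\kappa X^{1/12n}$, and $4A^3+27B^2\ne0$. Then there is a non-zero integer $D$ such that for all $X$ and all $(a,b)\in S_2(X)$, $\gcd(A^3,B^2)$ divides $D$. -}

module Defs where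

open import Data.Nat as ℕ using (ℕ; zero; suc; _∸_)
open import Data.Integer as ℤ using (ℤ)
open import Data.Rational as ℚ using (ℚ)
open import Data.List using (List; []; _∷_; length; map; last)
open import Data.List.Relation.Unary.All using (All)
open import Data.Maybe using (Maybe; just; nothing)
open import Data.Product using (∃; ∃₂; _×_)
open import Relation.Binary.PropositionalEquality using (_≡_; _≢_)

-- Polynomials are lists of coefficients, constant term first:
-- [c₀, c₁, …, c_d] represents c₀ + c₁ t + … + c_d t^d.
PolyZ : Set
PolyZ = List ℤ

PolyQ : Set
PolyQ = List ℚ

HasDegree : PolyZ → ℕ → Set
HasDegree f r = (length f ≡ suc r) × (∃ λ c → (last f ≡ just c) × (c ≢ ℤ.0ℤ))

toQ : PolyZ → PolyQ
toQ = map (λ c → c ℚ./ 1)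

addQ : PolyQ → PolyQ → PolyQ
addQ [] q = q
addQ (a ∷ p) [] = a ∷ p
addQ (a ∷ p) (b ∷ q) = (a ℚ.+ b) ∷ addQ p q

mulQ : PolyQ → PolyQ → PolyQ
mulQ [] q = []
mulQ (a ∷ p) q = addQ (map (a ℚ.*_) q) (ℚ.0ℚ ∷ mulQ p q)

IsZeroQ : PolyQ → Set
IsZeroQ = All (_≡ ℚ.0ℚ)

CoprimeQ[t] : PolyZ → PolyZ → Set
CoprimeQ[t] f g =
  ∃₂ λ (p q : PolyQ) →
    IsZeroQ (addQ (addQ (mulQ p (toQ f)) (mulQ q (toQ g))) (ℚ.-_ ℚ.1ℚ ∷ []))

-- homog f a b m e = Σᵢ fᵢ aⁱ b^(e - m i).
-- With e = 4n (resp. 6n) and deg f · m ≤ e this is exactly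
-- b^e · f(a / b^m) = u⁴ f(t) with u = bⁿ, t = a / b^m.
homog : PolyZ → ℤ → ℤ → ℕ → ℕ → ℤ
homog [] a b m e = ℤ.0ℤ
homog (c ∷ cs) a b m e = c ℤ.* (b ℤ.^ e) ℤ.+ a ℤ.* homog cs a b m (e ∸ m)

Aval : PolyZ → ℕ → ℕ → ℤ → ℤ → ℤ
Aval f n m a b = homog f a b m (4 ℕ.* n)

Bval : PolyZ → ℕ → ℕ → ℤ → ℤ → ℤ
Bval g n m a b = homog g a b m (6 ℕ.* n)

module Submission where

-- A relation p f + q g = 1 in ℚ[t], evaluated at
--    τ = a/bᵐ, multiplied by a suitable power of b and cleared of
--    denominators, gives K·bᵀ = X·A + Y·B with K ≠ 0 and T independent of
--    (a, b). Hence d = gcd(A³, B²) divides (K bᵀ)⁵ = K⁵ b^(5T).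
-- 2. Leading term. The weight condition max(6r, 4s)·m = 24n forces m·r = 4n or
--    m·s = 6n; then A ≡ c aʳ (resp. B ≡ c aˢ) modulo b, c the leading
--    coefficient, so A³ ≡ c³ a^(3r) (resp. B² ≡ c² a^(2s)) modulo b.
-- 3. Arithmetic. If gcd(a, b) = 1, d ∣ N bᵀ and d divides a number congruent
--    to c aᴷ modulo b, then d ∣ N cᵀ (gcd-bound).
-- So D = K⁵ (c³)^(5T), resp. K⁵ (c²)^(5T), works.

open import Defs
open import Data.Nat as ℕ using (ℕ; zero; suc; _⊔_; _>_)
open import Data.Nat.Coprimality using (Coprime)
open import Data.Integer as ℤ using (ℤ; ∣_∣)
open import Data.Integer.Divisibility using (_∣_)
open import Data.Integer.GCD using (gcd)
open import Data.Product using (∃; _×_)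
open import Data.Sum using (_⊎_)
open import Relation.Binary.PropositionalEquality using (_≡_; _≢_)

open import Data.Product using (∃₂; _,_; proj₁; proj₂)
open import Data.Sum using (inj₁; inj₂)
open import Data.List using ([]; _∷_; length; map; last)
import Data.List.Properties
open import Data.List.Relation.Unary.All using ([]; _∷_)
open import Data.Maybe using (just)
open import Relation.Binary.PropositionalEquality using (refl; sym; trans; cong; cong₂; subst; ≢-sym; module ≡-Reasoning)
import Data.Nat.Properties as ℕP
import Data.Nat.GCD as ℕGCD
open import Data.Nat.Divisibility as ℕ∣ using () renaming (_∣_ to _∣ₙ_)
open import Data.Nat.Coprimality using (coprime-divisor)
import Data.Nat.Tactic.RingSolver as ℕSolver
import Data.Integer.Properties as ℤP
open import Data.Integer.Divisibility.Signed as ℤ∣ using () renaming (_∣_ to _∣ₛ_)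
import Data.Integer.Solver as ℤSolver
open import Data.Rational as ℚ using (ℚ)
import Data.Rational.Properties as ℚP
import Data.Rational.Unnormalised as ℚᵘ
import Data.Rational.Unnormalised.Properties as ℚᵘP
open import Data.Rational.Solver using (module +-*-Solver)

ι : ℤ → ℚ
ι z = z ℚ./ 1

-- ι is an injective ring homomorphism. In the unnormalised rationals ι z is
-- just z/1, so these facts are checked there.
ι≃ : ∀ z → ℚ.toℚᵘ (ι z) ℚᵘ.≃ ℚᵘ.mkℚᵘ z 0
ι≃ z = ℚP.toℚᵘ-fromℚᵘ (ℚᵘ.mkℚᵘ z 0)

ι-injective : ∀ {x y} → ι x ≡ ι y → x ≡ y
ι-injective {x} {y} eq with ℚᵘP.≃-trans (ℚᵘP.≃-sym (ι≃ x)) (ℚᵘP.≃-trans (ℚP.toℚᵘ-cong eq) (ι≃ y))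
... | ℚᵘ.*≡* x*1≡y*1 = trans (sym (ℤP.*-identityʳ x)) (trans x*1≡y*1 (ℤP.*-identityʳ y))

ι-+ : ∀ x y → ι (x ℤ.+ y) ≡ ι x ℚ.+ ι y
ι-+ x y = ℚP.toℚᵘ-injective (begin
  ℚ.toℚᵘ (ι (x ℤ.+ y))              ≈⟨ ι≃ (x ℤ.+ y) ⟩
  ℚᵘ.mkℚᵘ (x ℤ.+ y) 0               ≈⟨ ℚᵘ.*≡* (solve 2 (λ x y → (x :+ y) :* (con ℤ.1ℤ :* con ℤ.1ℤ) := (x :* con ℤ.1ℤ :+ y :* con ℤ.1ℤ) :* con ℤ.1ℤ) refl x y) ⟩
  ℚᵘ.mkℚᵘ x 0 ℚᵘ.+ ℚᵘ.mkℚᵘ y 0      ≈⟨ ℚᵘP.+-cong (ι≃ x) (ι≃ y) ⟨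
  ℚ.toℚᵘ (ι x) ℚᵘ.+ ℚ.toℚᵘ (ι y)    ≈⟨ ℚP.toℚᵘ-homo-+ (ι x) (ι y) ⟨
  ℚ.toℚᵘ (ι x ℚ.+ ι y)              ∎)
  where
  open ℚᵘP.≃-Reasoning
  open ℤSolver.+-*-Solver

ι-* : ∀ x y → ι (x ℤ.* y) ≡ ι x ℚ.* ι y
ι-* x y = ℚP.toℚᵘ-injective (begin
  ℚ.toℚᵘ (ι (x ℤ.* y))              ≈⟨ ι≃ (x ℤ.* y) ⟩
  ℚᵘ.mkℚᵘ (x ℤ.* y) 0               ≈⟨ ℚᵘ.*≡* (solve 2 (λ x y → (x :* y) :* (con ℤ.1ℤ :* con ℤ.1ℤ) := (x :* y) :* con ℤ.1ℤ) refl x y) ⟩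
  ℚᵘ.mkℚᵘ x 0 ℚᵘ.* ℚᵘ.mkℚᵘ y 0      ≈⟨ ℚᵘP.*-cong (ι≃ x) (ι≃ y) ⟨
  ℚ.toℚᵘ (ι x) ℚᵘ.* ℚ.toℚᵘ (ι y)    ≈⟨ ℚP.toℚᵘ-homo-* (ι x) (ι y) ⟨
  ℚ.toℚᵘ (ι x ℚ.* ι y)              ∎)
  where
  open ℚᵘP.≃-Reasoning
  open ℤSolver.+-*-Solver

ι-denominator : ∀ c → ι (ℚ.↧ c) ℚ.* c ≡ ι (ℚ.↥ c)
ι-denominator c@(ℚ.mkℚ n d-1 _) = ℚP.toℚᵘ-injective (begin
  ℚ.toℚᵘ (ι d ℚ.* c)                 ≈⟨ ℚP.toℚᵘ-homo-* (ι d) c ⟩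
  ℚ.toℚᵘ (ι d) ℚᵘ.* ℚᵘ.mkℚᵘ n d-1    ≈⟨ ℚᵘP.*-congʳ (ι≃ d) ⟩
  ℚᵘ.mkℚᵘ d 0 ℚᵘ.* ℚᵘ.mkℚᵘ n d-1     ≈⟨ ℚᵘ.*≡* (solve 2 (λ d n → (d :* n) :* con ℤ.1ℤ := n :* (con ℤ.1ℤ :* d)) refl d n) ⟩
  ℚᵘ.mkℚᵘ n 0                        ≈⟨ ι≃ n ⟨
  ℚ.toℚᵘ (ι n)                       ∎)
  where
  open ℚᵘP.≃-Reasoning
  open ℤSolver.+-*-Solver
  d = ℤ.+ suc d-1

ev : PolyQ → ℚ → ℚ
ev []      x = ℚ.0ℚ
ev (c ∷ p) x = c ℚ.+ x ℚ.* ev p x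

module _ where
  open +-*-Solver

  ev-addQ : ∀ p q x → ev (addQ p q) x ≡ ev p x ℚ.+ ev q x
  ev-addQ []      q       x = sym (ℚP.+-identityˡ _)
  ev-addQ (a ∷ p) []      x = sym (ℚP.+-identityʳ _)
  ev-addQ (a ∷ p) (b ∷ q) x rewrite ev-addQ p q x =
    solve 5 (λ a b x u v → (a :+ b) :+ x :* (u :+ v) := (a :+ x :* u) :+ (b :+ x :* v)) refl a b x (ev p x) (ev q x)

  ev-scale : ∀ a q x → ev (map (a ℚ.*_) q) x ≡ a ℚ.* ev q x
  ev-scale a []      x = sym (ℚP.*-zeroʳ a)
  ev-scale a (c ∷ q) x rewrite ev-scale a q x =
    solve 4 (λ a c x u → a :* c :+ x :* (a :* u) := a :* (c :+ x :* u)) refl a c x (ev q x)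

  ev-mulQ : ∀ p q x → ev (mulQ p q) x ≡ ev p x ℚ.* ev q x
  ev-mulQ []      q x = sym (ℚP.*-zeroˡ (ev q x))
  ev-mulQ (a ∷ p) q x
    rewrite ev-addQ (map (a ℚ.*_) q) (ℚ.0ℚ ∷ mulQ p q) x | ev-scale a q x | ev-mulQ p q x =
    solve 4 (λ a x u v → a :* v :+ (con ℚ.0ℚ :+ x :* (u :* v)) := (a :+ x :* u) :* v) refl a x (ev p x) (ev q x)

  ev-zero : ∀ p x → IsZeroQ p → ev p x ≡ ℚ.0ℚ
  ev-zero []      x []            = refl
  ev-zero (c ∷ p) x (refl ∷ p≈0) rewrite ev-zero p x p≈0 =
    solve 1 (λ x → con ℚ.0ℚ :+ x :* con ℚ.0ℚ := con ℚ.0ℚ) refl x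

ev-bezout : ∀ p q F G x → IsZeroQ (addQ (addQ (mulQ p F) (mulQ q G)) (ℚ.- ℚ.1ℚ ∷ [])) →
  ev p x ℚ.* ev F x ℚ.+ ev q x ℚ.* ev G x ≡ ℚ.1ℚ
ev-bezout p q F G x bezout = begin
  S                                        ≡⟨ solve 2 (λ s x → s := (s :+ (:- con ℚ.1ℚ :+ x :* con ℚ.0ℚ)) :+ con ℚ.1ℚ) refl S x ⟩
  (S ℚ.+ ev (ℚ.- ℚ.1ℚ ∷ []) x) ℚ.+ ℚ.1ℚ    ≡⟨ cong (ℚ._+ ℚ.1ℚ) evaluated ⟩
  ℚ.0ℚ ℚ.+ ℚ.1ℚ                            ≡⟨ ℚP.+-identityˡ ℚ.1ℚ ⟩
  ℚ.1ℚ                                     ∎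
  where
  open ≡-Reasoning
  open +-*-Solver
  S = ev p x ℚ.* ev F x ℚ.+ ev q x ℚ.* ev G x
  evaluated : S ℚ.+ ev (ℚ.- ℚ.1ℚ ∷ []) x ≡ ℚ.0ℚ
  evaluated = begin
    S ℚ.+ ev (ℚ.- ℚ.1ℚ ∷ []) x
      ≡⟨ cong₂ (λ u v → u ℚ.+ v ℚ.+ _) (ev-mulQ p F x) (ev-mulQ q G x) ⟨
    ev (mulQ p F) x ℚ.+ ev (mulQ q G) x ℚ.+ ev (ℚ.- ℚ.1ℚ ∷ []) x
      ≡⟨ cong (ℚ._+ _) (ev-addQ (mulQ p F) (mulQ q G) x) ⟨
    ev (addQ (mulQ p F) (mulQ q G)) x ℚ.+ ev (ℚ.- ℚ.1ℚ ∷ []) x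
      ≡⟨ ev-addQ (addQ (mulQ p F) (mulQ q G)) _ x ⟨
    ev (addQ (addQ (mulQ p F) (mulQ q G)) (ℚ.- ℚ.1ℚ ∷ [])) x
      ≡⟨ ev-zero _ x bezout ⟩
    ℚ.0ℚ ∎

ev-toQ-scale : ∀ z P x → ev (toQ (map (z ℤ.*_) P)) x ≡ ι z ℚ.* ev (toQ P) x
ev-toQ-scale z []      x = sym (ℚP.*-zeroʳ (ι z))
ev-toQ-scale z (c ∷ P) x = begin
  ι (z ℤ.* c) ℚ.+ x ℚ.* ev (toQ (map (z ℤ.*_) P)) x
    ≡⟨ cong₂ (λ u v → u ℚ.+ x ℚ.* v) (ι-* z c) (ev-toQ-scale z P x) ⟩
  ι z ℚ.* ι c ℚ.+ x ℚ.* (ι z ℚ.* ev (toQ P) x)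
    ≡⟨ solve 4 (λ z c x u → z :* c :+ x :* (z :* u) := z :* (c :+ x :* u)) refl (ι z) (ι c) x (ev (toQ P) x) ⟩
  ι z ℚ.* (ι c ℚ.+ x ℚ.* ev (toQ P) x) ∎
  where
  open ≡-Reasoning
  open +-*-Solver

*-≢0 : ∀ {x y} → x ≢ ℤ.0ℤ → y ≢ ℤ.0ℤ → x ℤ.* y ≢ ℤ.0ℤ
*-≢0 {x} x≢0 y≢0 xy≡0 with ℤP.i*j≡0⇒i≡0∨j≡0 x xy≡0
... | inj₁ x≡0 = x≢0 x≡0
... | inj₂ y≡0 = y≢0 y≡0

clear-denominators : (p : PolyQ) → ∃ λ K → K ≢ ℤ.0ℤ × ∃ λ (P : PolyZ) →
  length P ≡ length p × (∀ x → ev (toQ P) x ≡ ι K ℚ.* ev p x)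
clear-denominators [] = ℤ.1ℤ , (λ ()) , [] , refl , λ x → sym (ℚP.*-zeroʳ (ι ℤ.1ℤ))
clear-denominators (c@(ℚ.mkℚ n d-1 _) ∷ p) with clear-denominators p
... | K , K≢0 , P , len , evP = d ℤ.* K , *-≢0 {d} (λ ()) K≢0 , n ℤ.* K ∷ map (d ℤ.*_) P ,
      cong suc (trans (Data.List.Properties.length-map (d ℤ.*_) P) len) , evaluated
  where
  open ≡-Reasoning
  open +-*-Solver
  d = ℤ.+ suc d-1
  evaluated : ∀ x → ev (toQ (n ℤ.* K ∷ map (d ℤ.*_) P)) x ≡ ι (d ℤ.* K) ℚ.* ev (c ∷ p) x
  evaluated x = begin
    ι (n ℤ.* K) ℚ.+ x ℚ.* ev (toQ (map (d ℤ.*_) P)) x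
      ≡⟨ cong₂ (λ u v → u ℚ.+ x ℚ.* v) (ι-* n K) (ev-toQ-scale d P x) ⟩
    ι n ℚ.* ι K ℚ.+ x ℚ.* (ι d ℚ.* ev (toQ P) x)
      ≡⟨ cong₂ (λ u v → u ℚ.* ι K ℚ.+ x ℚ.* (ι d ℚ.* v)) (sym (ι-denominator c)) (evP x) ⟩
    ι d ℚ.* c ℚ.* ι K ℚ.+ x ℚ.* (ι d ℚ.* (ι K ℚ.* ev p x))
      ≡⟨ solve 5 (λ d c K x u → d :* c :* K :+ x :* (d :* (K :* u)) := d :* K :* (c :+ x :* u)) refl (ι d) c (ι K) x (ev p x) ⟩
    ι d ℚ.* ι K ℚ.* (c ℚ.+ x ℚ.* ev p x)
      ≡⟨ cong (ℚ._* _) (ι-* d K) ⟨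
    ι (d ℤ.* K) ℚ.* (c ℚ.+ x ℚ.* ev p x) ∎

ι-^-+ : ∀ b x y → ι (b ℤ.^ x) ℚ.* ι (b ℤ.^ y) ≡ ι (b ℤ.^ (x ℕ.+ y))
ι-^-+ b x y = trans (sym (ι-* (b ℤ.^ x) (b ℤ.^ y))) (cong ι (sym (ℤP.^-distribˡ-+-* b x y)))

ι-^-split : ∀ b {m e} → m ℕ.≤ e → ι (b ℤ.^ m) ℚ.* ι (b ℤ.^ (e ℕ.∸ m)) ≡ ι (b ℤ.^ e)
ι-^-split b {m} {e} m≤e = trans (ι-^-+ b m (e ℕ.∸ m)) (cong (λ k → ι (b ℤ.^ k)) (ℕP.m+[n∸m]≡n m≤e))

module Homogenisation (a b : ℤ) (m : ℕ) (τ : ℚ) (bᵐτ≡a : ι (b ℤ.^ m) ℚ.* τ ≡ ι a) where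
  open ≡-Reasoning
  open +-*-Solver

  homog-eval : ∀ d cs e → length cs ℕ.≤ suc d → m ℕ.* d ℕ.≤ e →
    ι (homog cs a b m e) ≡ ι (b ℤ.^ e) ℚ.* ev (toQ cs) τ
  homog-eval d [] e _ _ = sym (ℚP.*-zeroʳ (ι (b ℤ.^ e)))
  homog-eval d (c ∷ []) e _ _ = begin
    ι (c ℤ.* b ℤ.^ e ℤ.+ a ℤ.* ℤ.0ℤ)   ≡⟨ cong ι (trans (cong (λ z → c ℤ.* b ℤ.^ e ℤ.+ z) (ℤP.*-zeroʳ a)) (ℤP.+-identityʳ (c ℤ.* b ℤ.^ e))) ⟩
    ι (c ℤ.* b ℤ.^ e)                  ≡⟨ ι-* c (b ℤ.^ e) ⟩
    ι c ℚ.* ι (b ℤ.^ e)                ≡⟨ solve 3 (λ c β τ → c :* β := β :* (c :+ τ :* con ℚ.0ℚ)) refl (ι c) (ι (b ℤ.^ e)) τ ⟩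
    ι (b ℤ.^ e) ℚ.* (ι c ℚ.+ τ ℚ.* ℚ.0ℚ) ∎
  homog-eval (suc d) (c ∷ cs@(_ ∷ _)) e (ℕ.s≤s len≤) md≤e = begin
    ι (c ℤ.* b ℤ.^ e ℤ.+ a ℤ.* H)
      ≡⟨ trans (ι-+ (c ℤ.* b ℤ.^ e) (a ℤ.* H)) (cong₂ ℚ._+_ (ι-* c (b ℤ.^ e)) (ι-* a H)) ⟩
    ι c ℚ.* ι (b ℤ.^ e) ℚ.+ ι a ℚ.* ι H
      ≡⟨ cong₂ (λ u v → ι c ℚ.* ι (b ℤ.^ e) ℚ.+ u ℚ.* v) (sym bᵐτ≡a) (homog-eval d cs e' len≤ md≤e') ⟩
    ι c ℚ.* ι (b ℤ.^ e) ℚ.+ ι (b ℤ.^ m) ℚ.* τ ℚ.* (ι (b ℤ.^ e') ℚ.* ev (toQ cs) τ)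
      ≡⟨ solve 6 (λ c β βᵐ τ βʳ E → c :* β :+ βᵐ :* τ :* (βʳ :* E) := c :* β :+ βᵐ :* βʳ :* (τ :* E))
                 refl (ι c) (ι (b ℤ.^ e)) (ι (b ℤ.^ m)) τ (ι (b ℤ.^ e')) (ev (toQ cs) τ) ⟩
    ι c ℚ.* ι (b ℤ.^ e) ℚ.+ ι (b ℤ.^ m) ℚ.* ι (b ℤ.^ e') ℚ.* (τ ℚ.* ev (toQ cs) τ)
      ≡⟨ cong (λ u → ι c ℚ.* ι (b ℤ.^ e) ℚ.+ u ℚ.* (τ ℚ.* ev (toQ cs) τ)) (ι-^-split b m≤e) ⟩
    ι c ℚ.* ι (b ℤ.^ e) ℚ.+ ι (b ℤ.^ e) ℚ.* (τ ℚ.* ev (toQ cs) τ)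
      ≡⟨ solve 3 (λ c β r → c :* β :+ β :* r := β :* (c :+ r)) refl (ι c) (ι (b ℤ.^ e)) (τ ℚ.* ev (toQ cs) τ) ⟩
    ι (b ℤ.^ e) ℚ.* (ι c ℚ.+ τ ℚ.* ev (toQ cs) τ) ∎
    where
    e' = e ℕ.∸ m
    H = homog cs a b m e'
    m+md≤e : m ℕ.+ m ℕ.* d ℕ.≤ e
    m+md≤e = ℕP.≤-trans (ℕP.≤-reflexive (sym (ℕP.*-suc m d))) md≤e
    m≤e : m ℕ.≤ e
    m≤e = ℕP.m+n≤o⇒m≤o m m+md≤e
    md≤e' : m ℕ.* d ℕ.≤ e'
    md≤e' = ℕP.m+n≤o⇒m≤o∸n (m ℕ.* d) (ℕP.≤-trans (ℕP.≤-reflexive (ℕP.+-comm (m ℕ.* d) m)) m+md≤e)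

affine-point : ∀ a b m → b ≢ ℤ.0ℤ → ∃ λ τ → ι (b ℤ.^ m) ℚ.* τ ≡ ι a
affine-point a b m b≢0 = ι a ℚ.÷ βᵐ , (begin
  βᵐ ℚ.* (ι a ℚ.* ℚ.1/ βᵐ)   ≡⟨ solve 3 (λ β a β⁻¹ → β :* (a :* β⁻¹) := a :* (β :* β⁻¹)) refl βᵐ (ι a) (ℚ.1/ βᵐ) ⟩
  ι a ℚ.* (βᵐ ℚ.* ℚ.1/ βᵐ)   ≡⟨ cong (ι a ℚ.*_) (ℚP.*-inverseʳ βᵐ) ⟩
  ι a ℚ.* ℚ.1ℚ               ≡⟨ ℚP.*-identityʳ (ι a) ⟩
  ι a                        ∎)
  where
  open ≡-Reasoning
  open +-*-Solver
  βᵐ = ι (b ℤ.^ m)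
  instance
    βᵐ-nonZero : ℚ.NonZero βᵐ
    βᵐ-nonZero = ℚ.≢-nonZero (λ βᵐ≡0 → b≢0 (ℤP.i^n≡0⇒i≡0 b m (ι-injective βᵐ≡0)))

weighted-bezout : ∀ k₁ k₂ βP βF βQ βG w p F q G →
  βP ℚ.* βF ≡ w → βQ ℚ.* βG ≡ w → p ℚ.* F ℚ.+ q ℚ.* G ≡ ℚ.1ℚ →
  k₂ ℚ.* (βP ℚ.* (k₁ ℚ.* p)) ℚ.* (βF ℚ.* F) ℚ.+ k₁ ℚ.* (βQ ℚ.* (k₂ ℚ.* q)) ℚ.* (βG ℚ.* G) ≡ k₁ ℚ.* k₂ ℚ.* w
weighted-bezout k₁ k₂ βP βF βQ βG w p F q G βPβF≡w βQβG≡w pF+qG≡1 = begin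
  k₂ ℚ.* (βP ℚ.* (k₁ ℚ.* p)) ℚ.* (βF ℚ.* F) ℚ.+ k₁ ℚ.* (βQ ℚ.* (k₂ ℚ.* q)) ℚ.* (βG ℚ.* G)
    ≡⟨ solve 10 (λ k₁ k₂ βP βF βQ βG p F q G →
                   k₂ :* (βP :* (k₁ :* p)) :* (βF :* F) :+ k₁ :* (βQ :* (k₂ :* q)) :* (βG :* G)
                := k₁ :* k₂ :* ((βP :* βF) :* (p :* F) :+ (βQ :* βG) :* (q :* G)))
               refl k₁ k₂ βP βF βQ βG p F q G ⟩
  k₁ ℚ.* k₂ ℚ.* ((βP ℚ.* βF) ℚ.* (p ℚ.* F) ℚ.+ (βQ ℚ.* βG) ℚ.* (q ℚ.* G))
    ≡⟨ cong₂ (λ u v → k₁ ℚ.* k₂ ℚ.* (u ℚ.* (p ℚ.* F) ℚ.+ v ℚ.* (q ℚ.* G))) βPβF≡w βQβG≡w ⟩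
  k₁ ℚ.* k₂ ℚ.* (w ℚ.* (p ℚ.* F) ℚ.+ w ℚ.* (q ℚ.* G))
    ≡⟨ cong (k₁ ℚ.* k₂ ℚ.*_) (ℚP.*-distribˡ-+ w (p ℚ.* F) (q ℚ.* G)) ⟨
  k₁ ℚ.* k₂ ℚ.* (w ℚ.* (p ℚ.* F ℚ.+ q ℚ.* G))
    ≡⟨ cong (λ u → k₁ ℚ.* k₂ ℚ.* (w ℚ.* u)) pF+qG≡1 ⟩
  k₁ ℚ.* k₂ ℚ.* (w ℚ.* ℚ.1ℚ)
    ≡⟨ cong (k₁ ℚ.* k₂ ℚ.*_) (ℚP.*-identityʳ w) ⟩
  k₁ ℚ.* k₂ ℚ.* w ∎
  where
  open ≡-Reasoning
  open +-*-Solver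

IntegralBezout : PolyZ → PolyZ → ℕ → ℕ → ℕ → Set
IntegralBezout f g m eF eG = ∃ λ K → K ≢ ℤ.0ℤ × ∃ λ T → (a b : ℤ) → b ≢ ℤ.0ℤ →
  ∃₂ λ X Y → K ℤ.* b ℤ.^ T ≡ X ℤ.* homog f a b m eF ℤ.+ Y ℤ.* homog g a b m eG

-- Proof: clear denominators in a Bézout relation p f + q g = 1, evaluate it at
-- τ = a / bᵐ and multiply by a power of b making every term integral.
integral-bezout : ∀ f g (m r s eF eG : ℕ) → length f ℕ.≤ suc r → length g ℕ.≤ suc s →
  m ℕ.* r ℕ.≤ eF → m ℕ.* s ℕ.≤ eG → CoprimeQ[t] f g → IntegralBezout f g m eF eG
integral-bezout f g m r s eF eG lenf leng mr≤eF ms≤eG (p , q , bezout)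
  with clear-denominators p | clear-denominators q
... | K₁ , K₁≢0 , P , lenP , evP | K₂ , K₂≢0 , Q , lenQ , evQ = K₁ ℤ.* K₂ , *-≢0 K₁≢0 K₂≢0 , T , combination
  where
  -- P and Q have degree at most d; they are homogenised with enough room
  -- that both products P·F and Q·G become homogeneous of degree T.
  d  = length p ℕ.+ length q
  eP = m ℕ.* d ℕ.+ eG
  eQ = m ℕ.* d ℕ.+ eF
  T  = eP ℕ.+ eF
  eQ+eG≡T : eQ ℕ.+ eG ≡ T
  eQ+eG≡T = begin
    m ℕ.* d ℕ.+ eF ℕ.+ eG     ≡⟨ ℕP.+-assoc (m ℕ.* d) eF eG ⟩
    m ℕ.* d ℕ.+ (eF ℕ.+ eG)   ≡⟨ cong (m ℕ.* d ℕ.+_) (ℕP.+-comm eF eG) ⟩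
    m ℕ.* d ℕ.+ (eG ℕ.+ eF)   ≡⟨ ℕP.+-assoc (m ℕ.* d) eG eF ⟨
    T                         ∎
    where open ≡-Reasoning
  lenP≤ : length P ℕ.≤ suc d
  lenP≤ = ℕP.m≤n⇒m≤1+n (ℕP.≤-trans (ℕP.≤-reflexive lenP) (ℕP.m≤m+n (length p) (length q)))
  lenQ≤ : length Q ℕ.≤ suc d
  lenQ≤ = ℕP.m≤n⇒m≤1+n (ℕP.≤-trans (ℕP.≤-reflexive lenQ) (ℕP.m≤n+m (length q) (length p)))

  combination-at : ∀ a b {τ} → ι (b ℤ.^ m) ℚ.* τ ≡ ι a →
    ∃₂ λ X Y → K₁ ℤ.* K₂ ℤ.* b ℤ.^ T ≡ X ℤ.* homog f a b m eF ℤ.+ Y ℤ.* homog g a b m eG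
  combination-at a b {τ} bᵐτ≡a = K₂ ℤ.* HP , K₁ ℤ.* HQ , ι-injective (begin
    ι (K₁ ℤ.* K₂ ℤ.* b ℤ.^ T)
      ≡⟨ trans (ι-* (K₁ ℤ.* K₂) (b ℤ.^ T)) (cong (ℚ._* β T) (ι-* K₁ K₂)) ⟩
    ι K₁ ℚ.* ι K₂ ℚ.* β T
      ≡⟨ weighted-bezout (ι K₁) (ι K₂) (β eP) (β eF) (β eQ) (β eG) (β T) (ev p τ) evF (ev q τ) evG
           (ι-^-+ b eP eF) (trans (ι-^-+ b eQ eG) (cong β eQ+eG≡T)) (ev-bezout p q (toQ f) (toQ g) τ bezout) ⟨
    ι K₂ ℚ.* (β eP ℚ.* (ι K₁ ℚ.* ev p τ)) ℚ.* (β eF ℚ.* evF) ℚ.+ ι K₁ ℚ.* (β eQ ℚ.* (ι K₂ ℚ.* ev q τ)) ℚ.* (β eG ℚ.* evG)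
      ≡⟨ cong₂ ℚ._+_ (cong₂ (λ u v → ι K₂ ℚ.* u ℚ.* v) ιHP ιF) (cong₂ (λ u v → ι K₁ ℚ.* u ℚ.* v) ιHQ ιG) ⟨
    ι K₂ ℚ.* ι HP ℚ.* ι F ℚ.+ ι K₁ ℚ.* ι HQ ℚ.* ι G
      ≡⟨ cong₂ ℚ._+_ (trans (ι-* (K₂ ℤ.* HP) F) (cong (ℚ._* ι F) (ι-* K₂ HP)))
                     (trans (ι-* (K₁ ℤ.* HQ) G) (cong (ℚ._* ι G) (ι-* K₁ HQ))) ⟨
    ι (K₂ ℤ.* HP ℤ.* F) ℚ.+ ι (K₁ ℤ.* HQ ℤ.* G)
      ≡⟨ ι-+ (K₂ ℤ.* HP ℤ.* F) (K₁ ℤ.* HQ ℤ.* G) ⟨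
    ι (K₂ ℤ.* HP ℤ.* F ℤ.+ K₁ ℤ.* HQ ℤ.* G) ∎)
    where
    open ≡-Reasoning
    open Homogenisation a b m τ bᵐτ≡a
    β : ℕ → ℚ
    β k = ι (b ℤ.^ k)
    F  = homog f a b m eF
    G  = homog g a b m eG
    HP = homog P a b m eP
    HQ = homog Q a b m eQ
    evF = ev (toQ f) τ
    evG = ev (toQ g) τ
    ιF : ι F ≡ β eF ℚ.* evF
    ιF = homog-eval r f eF lenf mr≤eF
    ιG : ι G ≡ β eG ℚ.* evG
    ιG = homog-eval s g eG leng ms≤eG
    ιHP : ι HP ≡ β eP ℚ.* (ι K₁ ℚ.* ev p τ)
    ιHP = trans (homog-eval d P eP lenP≤ (ℕP.m≤m+n (m ℕ.* d) eG)) (cong (β eP ℚ.*_) (evP τ))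
    ιHQ : ι HQ ≡ β eQ ℚ.* (ι K₂ ℚ.* ev q τ)
    ιHQ = trans (homog-eval d Q eQ lenQ≤ (ℕP.m≤m+n (m ℕ.* d) eF)) (cong (β eQ ℚ.*_) (evQ τ))

  combination : (a b : ℤ) → b ≢ ℤ.0ℤ →
    ∃₂ λ X Y → K₁ ℤ.* K₂ ℤ.* b ℤ.^ T ≡ X ℤ.* homog f a b m eF ℤ.+ Y ℤ.* homog g a b m eG
  combination a b b≢0 = combination-at a b (proj₂ (affine-point a b m b≢0))

homog-leading : ∀ (a b : ℤ) m' cs k c → length cs ≡ suc k → last cs ≡ just c →
  ∃ λ Y → homog cs a b (suc m') (suc m' ℕ.* k) ≡ c ℤ.* a ℤ.^ k ℤ.+ b ℤ.* Y
homog-leading a b m' (c ∷ []) zero .c refl refl = ℤ.0ℤ , (begin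
  c ℤ.* b ℤ.^ (suc m' ℕ.* 0) ℤ.+ a ℤ.* ℤ.0ℤ   ≡⟨ cong (λ e → c ℤ.* b ℤ.^ e ℤ.+ a ℤ.* ℤ.0ℤ) (ℕP.*-zeroʳ (suc m')) ⟩
  c ℤ.* ℤ.1ℤ ℤ.+ a ℤ.* ℤ.0ℤ                   ≡⟨ cong (λ z → c ℤ.* ℤ.1ℤ ℤ.+ z) (trans (ℤP.*-zeroʳ a) (sym (ℤP.*-zeroʳ b))) ⟩
  c ℤ.* ℤ.1ℤ ℤ.+ b ℤ.* ℤ.0ℤ                   ∎)
  where open ≡-Reasoning
homog-leading a b m' (c₀ ∷ c₁ ∷ cs) .(suc (length cs)) c refl last≡c
  with homog-leading a b m' (c₁ ∷ cs) (length cs) c refl last≡c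
... | Y , lower≡ = c₀ ℤ.* b ℤ.^ z ℤ.+ a ℤ.* Y , (begin
  c₀ ℤ.* b ℤ.^ (M ℕ.* suc L) ℤ.+ a ℤ.* homog (c₁ ∷ cs) a b M (M ℕ.* suc L ℕ.∸ M)
    ≡⟨ cong (λ e → c₀ ℤ.* b ℤ.^ (M ℕ.* suc L) ℤ.+ a ℤ.* homog (c₁ ∷ cs) a b M e) M[1+L]∸M≡ML ⟩
  c₀ ℤ.* (b ℤ.* b ℤ.^ z) ℤ.+ a ℤ.* homog (c₁ ∷ cs) a b M (M ℕ.* L)
    ≡⟨ cong (λ h → c₀ ℤ.* (b ℤ.* b ℤ.^ z) ℤ.+ a ℤ.* h) lower≡ ⟩
  c₀ ℤ.* (b ℤ.* b ℤ.^ z) ℤ.+ a ℤ.* (c ℤ.* a ℤ.^ L ℤ.+ b ℤ.* Y)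
    ≡⟨ solve 7 (λ c₀ b bᶻ a c aᴸ Y → c₀ :* (b :* bᶻ) :+ a :* (c :* aᴸ :+ b :* Y)
                                  := c :* (a :* aᴸ) :+ b :* (c₀ :* bᶻ :+ a :* Y))
               refl c₀ b (b ℤ.^ z) a c (a ℤ.^ L) Y ⟩
  c ℤ.* (a ℤ.* a ℤ.^ L) ℤ.+ b ℤ.* (c₀ ℤ.* b ℤ.^ z ℤ.+ a ℤ.* Y) ∎)
  where
  open ≡-Reasoning
  open ℤSolver.+-*-Solver
  L = length cs
  M = suc m'
  -- M·(1+L) = 1 + z definitionally, so b^(M·(1+L)) = b · bᶻ.
  z = L ℕ.+ m' ℕ.* suc L
  M[1+L]∸M≡ML : M ℕ.* suc L ℕ.∸ M ≡ M ℕ.* L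
  M[1+L]∸M≡ML = trans (cong (ℕ._∸ M) (ℕP.*-suc M L)) (ℕP.m+n∸m≡n M (M ℕ.* L))

^-distribʳ-* : ∀ x y j → (x ℤ.* y) ℤ.^ j ≡ x ℤ.^ j ℤ.* y ℤ.^ j
^-distribʳ-* x y zero    = refl
^-distribʳ-* x y (suc j) rewrite ^-distribʳ-* x y j =
  solve 4 (λ x y u v → x :* y :* (u :* v) := x :* u :* (y :* v)) refl x y (x ℤ.^ j) (y ℤ.^ j)
  where open ℤSolver.+-*-Solver

^-congruent : ∀ {x y} b Y j → x ≡ y ℤ.+ b ℤ.* Y → ∃ λ Z → x ℤ.^ j ≡ y ℤ.^ j ℤ.+ b ℤ.* Z
^-congruent {x} {y} b Y zero    _ = ℤ.0ℤ , sym (trans (cong (λ z → ℤ.1ℤ ℤ.+ z) (ℤP.*-zeroʳ b)) (ℤP.+-identityʳ ℤ.1ℤ))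
^-congruent {x} {y} b Y (suc j) x≡y+bY with ^-congruent b Y j x≡y+bY
... | Z , xʲ≡ = Y ℤ.* (y ℤ.^ j ℤ.+ b ℤ.* Z) ℤ.+ y ℤ.* Z , (begin
  x ℤ.* x ℤ.^ j                           ≡⟨ cong₂ ℤ._*_ x≡y+bY xʲ≡ ⟩
  (y ℤ.+ b ℤ.* Y) ℤ.* (y ℤ.^ j ℤ.+ b ℤ.* Z)
    ≡⟨ solve 5 (λ y b Y Z yʲ → (y :+ b :* Y) :* (yʲ :+ b :* Z) := y :* yʲ :+ b :* (Y :* (yʲ :+ b :* Z) :+ y :* Z))
               refl y b Y Z (y ℤ.^ j) ⟩
  y ℤ.* y ℤ.^ j ℤ.+ b ℤ.* (Y ℤ.* (y ℤ.^ j ℤ.+ b ℤ.* Z) ℤ.+ y ℤ.* Z) ∎)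
  where
  open ≡-Reasoning
  open ℤSolver.+-*-Solver

leading-power : ∀ (a b : ℤ) m' cs k c j {e} → length cs ≡ suc k → last cs ≡ just c → suc m' ℕ.* k ≡ e →
  ∃ λ Z → homog cs a b (suc m') e ℤ.^ j ≡ c ℤ.^ j ℤ.* a ℤ.^ (k ℕ.* j) ℤ.+ b ℤ.* Z
leading-power a b m' cs k c j len last≡c refl with homog-leading a b m' cs k c len last≡c
... | Y , lead with ^-congruent b Y j lead
... | Z , leadʲ = Z , trans leadʲ (cong (ℤ._+ b ℤ.* Z) (begin
  (c ℤ.* a ℤ.^ k) ℤ.^ j        ≡⟨ ^-distribʳ-* c (a ℤ.^ k) j ⟩
  c ℤ.^ j ℤ.* (a ℤ.^ k) ℤ.^ j  ≡⟨ cong (c ℤ.^ j ℤ.*_) (ℤP.^-*-assoc a k j) ⟩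
  c ℤ.^ j ℤ.* a ℤ.^ (k ℕ.* j)  ∎))
  where open ≡-Reasoning

-- If d ∣ M·y then d ∣ M·gcd(d, y), since d ∣ gcd(M·d, M·y) = M·gcd(d, y).
∣-*gcd : ∀ d M y → d ∣ₙ M ℕ.* y → d ∣ₙ M ℕ.* ℕGCD.gcd d y
∣-*gcd d M y d∣My =
  subst (d ∣ₙ_) (sym (ℕGCD.c*gcd[m,n]≡gcd[cm,cn] M d y)) (ℕGCD.gcd-greatest (ℕ∣.n∣m*n M) d∣My)

∣-*gcd^ : ∀ d M y k → d ∣ₙ M ℕ.* y ℕ.^ k → d ∣ₙ M ℕ.* ℕGCD.gcd d y ℕ.^ k
∣-*gcd^ d M y zero    d∣M = d∣M
∣-*gcd^ d M y (suc k) d∣Myᵏ⁺¹ =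
  subst (d ∣ₙ_) (ℕP.*-assoc M g (g ℕ.^ k))
    (∣-*gcd^ d (M ℕ.* g) y k
      (subst (d ∣ₙ_) (swap M (y ℕ.^ k) g)
        (∣-*gcd d (M ℕ.* y ℕ.^ k) y
          (subst (d ∣ₙ_) (trans (sym (ℕP.*-assoc M y (y ℕ.^ k))) (swap M y (y ℕ.^ k))) d∣Myᵏ⁺¹))))
  where
  g = ℕGCD.gcd d y
  swap : ∀ x u v → x ℕ.* u ℕ.* v ≡ x ℕ.* v ℕ.* u
  swap = ℕSolver.solve-∀

^-monoˡ-∣ : ∀ {h e} k → h ∣ₙ e → h ℕ.^ k ∣ₙ e ℕ.^ k
^-monoˡ-∣ zero    _   = ℕ∣.∣-refl
^-monoˡ-∣ (suc k) h∣e = ℕ∣.*-pres-∣ h∣e (^-monoˡ-∣ k h∣e)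

coprime-cancel-^ : ∀ {h x c} k → Coprime h x → h ∣ₙ c ℕ.* x ℕ.^ k → h ∣ₙ c
coprime-cancel-^ {h} {x} {c} zero    _   h∣c*1 = subst (h ∣ₙ_) (ℕP.*-identityʳ c) h∣c*1
coprime-cancel-^ {h} {x} {c} (suc k) h⊥x h∣cxᵏ⁺¹ =
  coprime-cancel-^ k h⊥x (coprime-divisor h⊥x (subst (h ∣ₙ_) (rearrange c x (x ℕ.^ k)) h∣cxᵏ⁺¹))
  where
  rearrange : ∀ c x u → c ℕ.* (x ℕ.* u) ≡ x ℕ.* (c ℕ.* u)
  rearrange = ℕSolver.solve-∀

abs-*^ : ∀ x y k → ∣ x ℤ.* y ℤ.^ k ∣ ≡ ∣ x ∣ ℕ.* ∣ y ∣ ℕ.^ k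
abs-*^ x y k = trans (ℤP.abs-* x (y ℤ.^ k)) (cong (∣ x ∣ ℕ.*_) (abs-^ k))
  where
  abs-^ : ∀ k → ∣ y ℤ.^ k ∣ ≡ ∣ y ∣ ℕ.^ k
  abs-^ zero    = refl
  abs-^ (suc k) = trans (ℤP.abs-* y (y ℤ.^ k)) (cong (∣ y ∣ ℕ.*_) (abs-^ k))

-- Then d ∣ N·cᵀ: the common part
-- h = gcd(d, b) of d and b divides c·aᴷ and is coprime to a, so h ∣ c,
-- while d ∣ N·bᵀ already forces d ∣ N·hᵀ.
gcd-bound : ∀ {d N b c a Z} T K → Coprime ∣ a ∣ ∣ b ∣ →
  d ∣ₛ N ℤ.* b ℤ.^ T → d ∣ₛ c ℤ.* a ℤ.^ K ℤ.+ b ℤ.* Z → d ∣ₛ N ℤ.* c ℤ.^ T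
gcd-bound {d} {N} {b} {c} {a} {Z} T K a⊥b d∣NbT d∣W =
  ℤ∣.∣ᵤ⇒∣ (subst (∣ d ∣ ∣ₙ_) (sym (abs-*^ N c T))
    (ℕ∣.∣-trans d∣Nhᵀ (ℕ∣.*-monoʳ-∣ (∣ N ∣) (^-monoˡ-∣ T h∣c))))
  where
  h = ℕGCD.gcd (∣ d ∣) (∣ b ∣)
  h∣b : h ∣ₙ ∣ b ∣
  h∣b = ℕGCD.gcd[m,n]∣n (∣ d ∣) (∣ b ∣)
  h⊥a : Coprime h ∣ a ∣
  h⊥a (i∣h , i∣a) = a⊥b (i∣a , ℕ∣.∣-trans i∣h h∣b)
  h∣caᴷ : ℤ.+ h ∣ₛ c ℤ.* a ℤ.^ K
  h∣caᴷ = ℤ∣.∣m+n∣n⇒∣m (ℤ∣.∣-trans (ℤ∣.∣ᵤ⇒∣ (ℕGCD.gcd[m,n]∣m (∣ d ∣) (∣ b ∣))) d∣W)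
                        (ℤ∣.∣m⇒∣m*n Z (ℤ∣.∣ᵤ⇒∣ {i = b} h∣b))
  h∣c : h ∣ₙ ∣ c ∣
  h∣c = coprime-cancel-^ K h⊥a (subst (h ∣ₙ_) (abs-*^ c a K) (ℤ∣.∣⇒∣ᵤ h∣caᴷ))
  d∣Nhᵀ : ∣ d ∣ ∣ₙ ∣ N ∣ ℕ.* h ℕ.^ T
  d∣Nhᵀ = ∣-*gcd^ (∣ d ∣) (∣ N ∣) (∣ b ∣) T (subst (∣ d ∣ ∣ₙ_) (abs-*^ N b T) (ℤ∣.∣⇒∣ᵤ d∣NbT))

-- Every element (X A + Y B)⁵ of (A, B)⁵ lies in (A³, B²): each monomial
-- Aⁱ Bʲ with i + j = 5 has i ≥ 3 or j ≥ 2.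
∣-fifth-power : ∀ {d} A B X Y → d ∣ₛ A ℤ.^ 3 → d ∣ₛ B ℤ.^ 2 → d ∣ₛ (X ℤ.* A ℤ.+ Y ℤ.* B) ℤ.^ 5
∣-fifth-power {d} A B X Y d∣A³ d∣B² =
  subst (d ∣ₛ_) (sym (expansion X Y A B)) (ℤ∣.∣m∣n⇒∣m+n (ℤ∣.∣m⇒∣m*n _ d∣A³) (ℤ∣.∣m⇒∣m*n _ d∣B²))
  where
  open ℤSolver.+-*-Solver
  expansion : ∀ X Y A B → (X ℤ.* A ℤ.+ Y ℤ.* B) ℤ.^ 5
    ≡ A ℤ.^ 3 ℤ.* (X ℤ.^ 5 ℤ.* A ℤ.^ 2 ℤ.+ ℤ.+ 5 ℤ.* X ℤ.^ 4 ℤ.* Y ℤ.* A ℤ.* B ℤ.+ ℤ.+ 10 ℤ.* X ℤ.^ 3 ℤ.* Y ℤ.^ 2 ℤ.* B ℤ.^ 2)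
      ℤ.+ B ℤ.^ 2 ℤ.* (ℤ.+ 10 ℤ.* X ℤ.^ 2 ℤ.* Y ℤ.^ 3 ℤ.* A ℤ.^ 2 ℤ.* B ℤ.+ ℤ.+ 5 ℤ.* X ℤ.* Y ℤ.^ 4 ℤ.* A ℤ.* B ℤ.^ 2 ℤ.+ Y ℤ.^ 5 ℤ.* B ℤ.^ 3)
  expansion = solve 4 (λ X Y A B → (X :* A :+ Y :* B) :^ 5 :=
      A :^ 3 :* (X :^ 5 :* A :^ 2 :+ con (ℤ.+ 5) :* X :^ 4 :* Y :* A :* B :+ con (ℤ.+ 10) :* X :^ 3 :* Y :^ 2 :* B :^ 2)
      :+ B :^ 2 :* (con (ℤ.+ 10) :* X :^ 2 :* Y :^ 3 :* A :^ 2 :* B :+ con (ℤ.+ 5) :* X :* Y :^ 4 :* A :* B :^ 2 :+ Y :^ 5 :* B :^ 3))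
    refl

gcd-divides : ∀ {A B a b c} K T L → Coprime ∣ a ∣ ∣ b ∣ →
  (∃₂ λ X Y → K ℤ.* b ℤ.^ T ≡ X ℤ.* A ℤ.+ Y ℤ.* B) →
  (∃ λ Z → A ℤ.^ 3 ≡ c ℤ.* a ℤ.^ L ℤ.+ b ℤ.* Z) ⊎ (∃ λ Z → B ℤ.^ 2 ≡ c ℤ.* a ℤ.^ L ℤ.+ b ℤ.* Z) →
  gcd (A ℤ.^ 3) (B ℤ.^ 2) ∣ K ℤ.^ 5 ℤ.* c ℤ.^ (T ℕ.* 5)
gcd-divides {A} {B} {a} {b} {c} K T L a⊥b (X , Y , KbᵀInIdeal) leading =
  ℤ∣.∣⇒∣ᵤ (gcd-bound {N = K ℤ.^ 5} {c = c} {a = a} (T ℕ.* 5) L a⊥b (subst (d ∣ₛ_) fifth-power d∣[XA+YB]⁵) (proj₂ (d∣leading {c} {L} leading)))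
  where
  d = gcd (A ℤ.^ 3) (B ℤ.^ 2)
  d∣A³ : d ∣ₛ A ℤ.^ 3
  d∣A³ = ℤ∣.∣ᵤ⇒∣ (Data.Integer.GCD.gcd[i,j]∣i (A ℤ.^ 3) (B ℤ.^ 2))
  d∣B² : d ∣ₛ B ℤ.^ 2
  d∣B² = ℤ∣.∣ᵤ⇒∣ (Data.Integer.GCD.gcd[i,j]∣j (A ℤ.^ 3) (B ℤ.^ 2))
  d∣leading : ∀ {c L} → (∃ λ Z → A ℤ.^ 3 ≡ c ℤ.* a ℤ.^ L ℤ.+ b ℤ.* Z) ⊎ (∃ λ Z → B ℤ.^ 2 ≡ c ℤ.* a ℤ.^ L ℤ.+ b ℤ.* Z) →
    ∃ λ Z → d ∣ₛ c ℤ.* a ℤ.^ L ℤ.+ b ℤ.* Z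
  d∣leading (inj₁ (Z , A³≡)) = Z , subst (d ∣ₛ_) A³≡ d∣A³
  d∣leading (inj₂ (Z , B²≡)) = Z , subst (d ∣ₛ_) B²≡ d∣B²
  d∣[XA+YB]⁵ : d ∣ₛ (X ℤ.* A ℤ.+ Y ℤ.* B) ℤ.^ 5
  d∣[XA+YB]⁵ = ∣-fifth-power A B X Y d∣A³ d∣B²
  fifth-power : (X ℤ.* A ℤ.+ Y ℤ.* B) ℤ.^ 5 ≡ K ℤ.^ 5 ℤ.* b ℤ.^ (T ℕ.* 5)
  fifth-power = begin
    (X ℤ.* A ℤ.+ Y ℤ.* B) ℤ.^ 5    ≡⟨ cong (ℤ._^ 5) KbᵀInIdeal ⟨
    (K ℤ.* b ℤ.^ T) ℤ.^ 5          ≡⟨ ^-distribʳ-* K (b ℤ.^ T) 5 ⟩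
    K ℤ.^ 5 ℤ.* (b ℤ.^ T) ℤ.^ 5    ≡⟨ cong (K ℤ.^ 5 ℤ.*_) (ℤP.^-*-assoc b T 5) ⟩
    K ℤ.^ 5 ℤ.* b ℤ.^ (T ℕ.* 5)    ∎
    where open ≡-Reasoning

weight-≤ : ∀ k {x y m M} .{{_ : ℕ.NonZero k}} → k ℕ.* x ℕ.≤ M → M ℕ.* m ≡ k ℕ.* y → m ℕ.* x ℕ.≤ y
weight-≤ k {x} {y} {m} {M} kx≤M Mm≡ky = ℕP.*-cancelˡ-≤ k (begin
  k ℕ.* (m ℕ.* x)   ≡⟨ trans (cong (k ℕ.*_) (ℕP.*-comm m x)) (sym (ℕP.*-assoc k x m)) ⟩
  k ℕ.* x ℕ.* m     ≤⟨ ℕP.*-monoˡ-≤ m kx≤M ⟩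
  M ℕ.* m           ≡⟨ Mm≡ky ⟩
  k ℕ.* y           ∎)
  where open ℕP.≤-Reasoning

weight-≡ : ∀ k {x y m M} .{{_ : ℕ.NonZero k}} → k ℕ.* x ≡ M → M ℕ.* m ≡ k ℕ.* y → m ℕ.* x ≡ y
weight-≡ k {x} {y} {m} {M} kx≡M Mm≡ky = ℕP.*-cancelˡ-≡ (m ℕ.* x) y k (begin
  k ℕ.* (m ℕ.* x)   ≡⟨ trans (cong (k ℕ.*_) (ℕP.*-comm m x)) (sym (ℕP.*-assoc k x m)) ⟩
  k ℕ.* x ℕ.* m     ≡⟨ cong (ℕ._* m) kx≡M ⟩
  M ℕ.* m           ≡⟨ Mm≡ky ⟩
  k ℕ.* y           ∎)
  where open ≡-Reasoning

weights-bounded : ∀ r s n m → ((6 ℕ.* r) ⊔ (4 ℕ.* s)) ℕ.* m ≡ 24 ℕ.* n →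
  m ℕ.* r ℕ.≤ 4 ℕ.* n × m ℕ.* s ℕ.≤ 6 ℕ.* n
weights-bounded r s n m weights =
  weight-≤ 6 (ℕP.m≤m⊔n (6 ℕ.* r) (4 ℕ.* s)) (trans weights (ℕP.*-assoc 6 4 n)) ,
  weight-≤ 4 (ℕP.m≤n⊔m (6 ℕ.* r) (4 ℕ.* s)) (trans weights (ℕP.*-assoc 4 6 n))

weights-attained : ∀ r s n m → ((6 ℕ.* r) ⊔ (4 ℕ.* s)) ℕ.* m ≡ 24 ℕ.* n →
  m ℕ.* r ≡ 4 ℕ.* n ⊎ m ℕ.* s ≡ 6 ℕ.* n
weights-attained r s n m weights with ℕP.⊔-sel (6 ℕ.* r) (4 ℕ.* s)
... | inj₁ max≡6r = inj₁ (weight-≡ 6 (sym max≡6r) (trans weights (ℕP.*-assoc 6 4 n)))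
... | inj₂ max≡4s = inj₂ (weight-≡ 4 (sym max≡4s) (trans weights (ℕP.*-assoc 4 6 n)))

^-≢0 : ∀ x k → x ≢ ℤ.0ℤ → x ℤ.^ k ≢ ℤ.0ℤ
^-≢0 x k x≢0 xᵏ≡0 = x≢0 (ℤP.i^n≡0⇒i≡0 x k xᵏ≡0)

bound-≢0 : ∀ {K c} T → K ≢ ℤ.0ℤ → c ≢ ℤ.0ℤ → K ℤ.^ 5 ℤ.* c ℤ.^ (T ℕ.* 5) ≢ ℤ.0ℤ
bound-≢0 {K} {c} T K≢0 c≢0 = *-≢0 (^-≢0 K 5 K≢0) (^-≢0 c (T ℕ.* 5) c≢0)

>0⇒≢0 : ∀ {b} → b ℤ.> ℤ.0ℤ → b ≢ ℤ.0ℤ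
>0⇒≢0 b>0 = ≢-sym (ℤP.<⇒≢ b>0)

GcdBound : PolyZ → PolyZ → ℕ → ℕ → ℤ → Set
GcdBound f g n m D = (a b : ℤ) → Coprime ∣ a ∣ ∣ b ∣ → b ℤ.> ℤ.0ℤ →
  (ℤ.+ 4) ℤ.* (Aval f n m a b ℤ.^ 3) ℤ.+ (ℤ.+ 27) ℤ.* (Bval g n m a b ℤ.^ 2) ≢ ℤ.0ℤ →
  gcd (Aval f n m a b ℤ.^ 3) (Bval g n m a b ℤ.^ 2) ∣ D

-- Lemma 2.6. The integral Bézout identity puts K·bᵀ in (A, B); whichever of
-- f, g carries the maximal weight makes A³ or B² congruent to a power of a
-- times a fixed constant modulo b, and gcd-divides turns this into a bound
-- independent of (a, b).
lemma2p6 : (f g : PolyZ) (r s n m : ℕ) →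
    HasDegree f r → HasDegree g s → CoprimeQ[t] f g →
    (r > 0 ⊎ s > 0) →
    n > 0 → m > 0 → Coprime n m →
    ((6 ℕ.* r) ⊔ (4 ℕ.* s)) ℕ.* m ≡ 24 ℕ.* n →
    (n ≡ 1 ⊎ m ≡ 1) →
    ∃ λ (D : ℤ) → (D ≢ ℤ.0ℤ) ×
      ((a b : ℤ) → Coprime ∣ a ∣ ∣ b ∣ → b ℤ.> ℤ.0ℤ →
        (ℤ.+ 4) ℤ.* (Aval f n m a b ℤ.^ 3) ℤ.+ (ℤ.+ 27) ℤ.* (Bval g n m a b ℤ.^ 2) ≢ ℤ.0ℤ →
        gcd (Aval f n m a b ℤ.^ 3) (Bval g n m a b ℤ.^ 2) ∣ D)
lemma2p6 f g r s n zero _ _ _ _ _ () _ _ _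
lemma2p6 f g r s n m@(suc m') (lenf , cf , lastf , cf≢0) (leng , cg , lastg , cg≢0) f⊥g _ _ _ _ weights _ =
  bound (integral-bezout f g m r s (4 ℕ.* n) (6 ℕ.* n) (ℕP.≤-reflexive lenf) (ℕP.≤-reflexive leng)
                         (proj₁ (weights-bounded r s n m weights)) (proj₂ (weights-bounded r s n m weights)) f⊥g)
        (weights-attained r s n m weights)
  where
  bound : IntegralBezout f g m (4 ℕ.* n) (6 ℕ.* n) → m ℕ.* r ≡ 4 ℕ.* n ⊎ m ℕ.* s ≡ 6 ℕ.* n →
          ∃ λ D → D ≢ ℤ.0ℤ × GcdBound f g n m D
  bound (K , K≢0 , T , bezout) (inj₁ mr≡4n) =
    K ℤ.^ 5 ℤ.* (cf ℤ.^ 3) ℤ.^ (T ℕ.* 5) , bound-≢0 T K≢0 (^-≢0 cf 3 cf≢0) , λ a b a⊥b b>0 _ →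
      gcd-divides K T (r ℕ.* 3) a⊥b (bezout a b (>0⇒≢0 b>0)) (inj₁ (leading-power a b m' f r cf 3 lenf lastf mr≡4n))
  bound (K , K≢0 , T , bezout) (inj₂ ms≡6n) =
    K ℤ.^ 5 ℤ.* (cg ℤ.^ 2) ℤ.^ (T ℕ.* 5) , bound-≢0 T K≢0 (^-≢0 cg 2 cg≢0) , λ a b a⊥b b>0 _ →
      gcd-divides K T (s ℕ.* 2) a⊥b (bezout a b (>0⇒≢0 b>0)) (inj₂ (leading-power a b m' g s cg 2 leng lastg ms≡6n))
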